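{- For every integer $n\ge 4$, the number of permutations of $[n]$ that contain no occurrence of the pattern $123$ and exactly three occurrences of the pattern $132$ equals \[ \binom{n-3}{1}2^{n-4}+\binom{n-3}{2}2^{n-5}+\binom{n-4}{3}2^{n-7}. \]
   Context: A permutation of $[n]$ is a word $\pi_1\cdots\pi_n$. An occurrence of $123$ in $\pi$ is a triple of positions $i<j<k$ with $\pi_i<\pi_j<\pi_k$; an occurrence of $132$ is a triple of positions $i<j<k$ with $\pi_i<\pi_k<\pi_j$. -}

module Defs where

open import Data.Nat using (ℕ; zero; suc; _+_; _*_; _∸_; _^_; _<ᵇ_; _≡ᵇ_)
open import Data.Bool using (Bool; true; false; _∧_; if_then_else_)
open import Data.Fin using (Fin; toℕ)
open import Data.List using (List; []; _∷_; map; concatMap; filter; length; allFin)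
open import Data.Nat.ListAction using (sum)
open import Data.Bool.ListAction using (all)
open import Data.Vec using (Vec; []; _∷_; lookup)
open import Relation.Binary.PropositionalEquality using (_≡_)
open import Data.Bool.Properties using (T?)

words : (n k : ℕ) → List (Vec (Fin n) k)
words n zero = []  ∷ []
words n (suc k) = concatMap (λ a → map (a ∷_) (words n k)) (allFin n)

-- A word π₁⋯πₙ over [n] (0-indexed here) is a permutation iff its letters are pairwise distinct.
isPerm : {n : ℕ} → Vec (Fin n) n → Bool
isPerm {n} w =
  all (λ i → all (λ j → if toℕ i <ᵇ toℕ j
                        then (if toℕ (lookup w i) ≡ᵇ toℕ (lookup w j) then false else true)
                        else true) (allFin n)) (allFin n)

ind : Bool → ℕ
ind true = 1
ind false = 0

countTriples : {n : ℕ} → (ℕ → ℕ → ℕ → Bool) → Vec (Fin n) n → ℕ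
countTriples {n} P w =
  sum (map (λ i → sum (map (λ j → sum (map (λ k →
      ind ((toℕ i <ᵇ toℕ j) ∧ (toℕ j <ᵇ toℕ k)
           ∧ P (toℕ (lookup w i)) (toℕ (lookup w j)) (toℕ (lookup w k))))
    (allFin n))) (allFin n))) (allFin n))

occ123 : {n : ℕ} → Vec (Fin n) n → ℕ
occ123 = countTriples (λ a b c → (a <ᵇ b) ∧ (b <ᵇ c))

occ132 : {n : ℕ} → Vec (Fin n) n → ℕ
occ132 = countTriples (λ a b c → (a <ᵇ c) ∧ (c <ᵇ b))

isTarget : {n : ℕ} → Vec (Fin n) n → Bool
isTarget w = isPerm w ∧ (occ123 w ≡ᵇ 0) ∧ (occ132 w ≡ᵇ 3)

countTarget : ℕ → ℕ
countTarget n = length (filter (λ w → T? (isTarget w)) (words n n))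

-- Read a permutation from left to right, keeping track of its current minimum b. If it avoids 123,
-- a letter x above b must exceed no later letter (b x z would be a 123), while a new minimum x with
-- c later letters above it is the 1 of exactly C(c,2) occurrences of 132: two later letters above x
-- cannot be increasing. So the number of completions depends only on how many letters remain, how
-- many of them lie above b, and how many 132's are still to be produced. The resulting recurrence
-- is solved for at most three 132's: at length 9 + j its values are 2^j times cubic polynomials in j,
-- which are checked against the recurrence coefficientwise.
module Submission where

open import Defs
open import Data.Nat
  using (ℕ; zero; suc; _+_; _*_; _∸_; _^_; _≤_; _<_; _>_; _<ᵇ_; _≡ᵇ_; _≤ᵇ_; z≤n; s≤s; s≤s⁻¹)
open import Data.Nat.Properties
open import Data.Nat.ListAction using (sum)
open import Data.Nat.Combinatorics using (_C_; nC1≡n; nCk+nC[k+1]≡[n+1]C[k+1])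
open import Data.Nat.Tactic.RingSolver using (solve-∀)
open import Algebra.Properties.CommutativeSemigroup +-commutativeSemigroup
  using () renaming (interchange to +-interchange; x∙yz≈y∙xz to +-exchange)
open import Algebra.Properties.CommutativeSemigroup *-commutativeSemigroup
  using () renaming (x∙yz≈y∙xz to *-exchange)
open import Data.Bool using (Bool; true; false; T; not; _∧_; _∨_; if_then_else_)
open import Data.Bool.ListAction using (all; and)
open import Data.Bool.Properties using (T?; T-≡; T-not-≡; T-∨; T-∧; ∧-zeroʳ; ∧-identityʳ; ∧-assoc)
open import Data.Empty using (⊥-elim)
open import Data.Unit using (tt)
open import Data.Maybe using (Maybe; just; nothing)
open import Data.Product using (_×_; _,_; proj₁; proj₂)
open import Data.Sum using (inj₁; inj₂)
open import Data.Fin using (Fin; toℕ; fromℕ<) renaming (zero to fzero; suc to fsuc)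
open import Data.Fin.Properties using (toℕ<n; toℕ≤pred[n]; toℕ-fromℕ<; all?)
open import Data.List using (List; []; _∷_; map; concatMap; filter; length; allFin; tabulate; downFrom; _++_)
open import Data.List.Properties
  using (map-tabulate; tabulate-cong; map-cong; map-cong-local; length-tabulate; length-downFrom)
open import Data.List.Relation.Unary.All using (All; []; _∷_) renaming (map to All-map)
open import Data.List.Relation.Unary.All.Properties using (applyDownFrom⁺₁)
open import Data.List.Relation.Unary.AllPairs using (AllPairs; []; _∷_)
open import Data.Vec using (Vec; []; _∷_; lookup; zipWith)
import Data.Vec as Vec
open import Data.Vec.Properties using (≡-dec)
open import Function using (_∘_)
open import Function.Bundles using (_⇔_; mk⇔; Equivalence)
open Equivalence using (to; from)
open import Relation.Binary.PropositionalEquality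
  using (_≡_; refl; sym; trans; cong; cong₂; subst; subst₂; module ≡-Reasoning)
open import Relation.Nullary using (¬_; Dec; yes; no)
open import Relation.Nullary.Decidable using (from-yes)
open import Relation.Nullary.Reflects using (Reflects; ofʸ; ofⁿ; fromEquivalence)

T⇒≡true : ∀ {b} → T b → b ≡ true
T⇒≡true = to T-≡

¬T⇒≡false : ∀ {b} → ¬ T b → b ≡ false
¬T⇒≡false {false} _ = refl
¬T⇒≡false {true} ¬t = ⊥-elim (¬t _)

T-injective : ∀ {a b} → (T a → T b) → (T b → T a) → a ≡ b
T-injective {false} {false} _ _ = refl
T-injective {false} {true} _ b⇒a = ⊥-elim (b⇒a _)
T-injective {true} {false} a⇒b _ = ⊥-elim (a⇒b _)
T-injective {true} {true} _ _ = refl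

ind≡0⇒¬T : ∀ {b} → ind b ≡ 0 → ¬ T b
ind≡0⇒¬T {true} ()

ind-mono : ∀ {a b} → (T a → T b) → ind a ≤ ind b
ind-mono {false} _ = z≤n
ind-mono {true} a⇒b rewrite T⇒≡true (a⇒b _) = ≤-refl

≡ᵇ-reflects-≡ : ∀ m n → Reflects (m ≡ n) (m ≡ᵇ n)
≡ᵇ-reflects-≡ m n = fromEquivalence (≡ᵇ⇒≡ m n) (≡⇒≡ᵇ m n)

≡ᵇ-refl : ∀ n → (n ≡ᵇ n) ≡ true
≡ᵇ-refl n = T⇒≡true (≡⇒≡ᵇ n n refl)

<ᵇ-true : ∀ {m n} → m < n → (m <ᵇ n) ≡ true
<ᵇ-true m<n = T⇒≡true (<⇒<ᵇ m<n)

<ᵇ-false : ∀ {m n} → n ≤ m → (m <ᵇ n) ≡ false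
<ᵇ-false {m} {n} n≤m = ¬T⇒≡false (λ m<ᵇn → <⇒≱ (<ᵇ⇒< m n m<ᵇn) n≤m)

if-then-false-else-true : ∀ b → (if b then false else true) ≡ not b
if-then-false-else-true true = refl
if-then-false-else-true false = refl

if-∨-disjoint : ∀ p {q} (N : ℕ) → (T p → q ≡ false) →
  (if p ∨ q then N else 0) ≡ (if p then N else 0) + (if q then N else 0)
if-∨-disjoint true N q≡false rewrite q≡false _ = sym (+-identityʳ N)
if-∨-disjoint false N _ = refl

∧-congʳ-under : ∀ p {q q′} → (T p → T q → q ≡ q′) → (T p → T q′ → q ≡ q′) →
  p ∧ q ≡ p ∧ q′
∧-congʳ-under false _ _ = refl
∧-congʳ-under true {false} {false} _ _ = refl
∧-congʳ-under true {true} q⇒ _ = q⇒ _ _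
∧-congʳ-under true {false} {true} _ q′⇒ = q′⇒ _ _

∧-swapˡ : ∀ p c q → p ∧ (c ∧ q) ≡ c ∧ (p ∧ q)
∧-swapˡ p true q = refl
∧-swapˡ p false q = ∧-zeroʳ p

∑ : (k : ℕ) → (Fin k → ℕ) → ℕ
∑ k f = sum (tabulate f)

sum-map-allFin : ∀ k (f : Fin k → ℕ) → sum (map f (allFin k)) ≡ ∑ k f
sum-map-allFin k f = cong sum (map-tabulate (λ i → i) f)

∑-cong : ∀ k {f g : Fin k → ℕ} → (∀ i → f i ≡ g i) → ∑ k f ≡ ∑ k g
∑-cong k eq = cong sum (tabulate-cong eq)

∑-zero : ∀ k → ∑ k (λ _ → 0) ≡ 0
∑-zero zero = refl
∑-zero (suc k) = ∑-zero k

∑-+ : ∀ k (f g : Fin k → ℕ) → ∑ k (λ i → f i + g i) ≡ ∑ k f + ∑ k g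
∑-+ zero f g = refl
∑-+ (suc k) f g = trans (cong (f fzero + g fzero +_) (∑-+ k (f ∘ fsuc) (g ∘ fsuc)))
                        (+-interchange (f fzero) (g fzero) _ _)

∑-delta : ∀ k a (f : ℕ → ℕ) → a < k → ∑ k (λ i → if toℕ i ≡ᵇ a then f (toℕ i) else 0) ≡ f a
∑-delta (suc k) zero f _ = trans (cong (f 0 +_) (∑-zero k)) (+-identityʳ (f 0))
∑-delta (suc k) (suc a) f (s≤s a<k) = ∑-delta k a (f ∘ suc) a<k

count : {A : Set} → (A → Bool) → List A → ℕ
count p [] = 0
count p (x ∷ xs) = ind (p x) + count p xs

length-filter : {A : Set} (p : A → Bool) (xs : List A) → length (filter (T? ∘ p) xs) ≡ count p xs
length-filter p [] = refl
length-filter p (x ∷ xs) with p x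
... | true = cong suc (length-filter p xs)
... | false = length-filter p xs

count-++ : {A : Set} (p : A → Bool) (xs ys : List A) → count p (xs ++ ys) ≡ count p xs + count p ys
count-++ p [] ys = refl
count-++ p (x ∷ xs) ys = trans (cong (ind (p x) +_) (count-++ p xs ys)) (sym (+-assoc (ind (p x)) _ _))

count-map : {A B : Set} (p : B → Bool) (f : A → B) (xs : List A) → count p (map f xs) ≡ count (p ∘ f) xs
count-map p f [] = refl
count-map p f (x ∷ xs) = cong (ind (p (f x)) +_) (count-map p f xs)

count-concatMap : {A B : Set} (p : B → Bool) (f : A → List B) (xs : List A) →
  count p (concatMap f xs) ≡ sum (map (count p ∘ f) xs)
count-concatMap p f [] = refl
count-concatMap p f (x ∷ xs) =
  trans (count-++ p (f x) (concatMap f xs)) (cong (count p (f x) +_) (count-concatMap p f xs))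

count-cong : {A : Set} {p q : A → Bool} (xs : List A) → (∀ x → p x ≡ q x) → count p xs ≡ count q xs
count-cong [] eq = refl
count-cong (x ∷ xs) eq = cong₂ _+_ (cong ind (eq x)) (count-cong xs eq)

count-cong-All : {A : Set} {p q : A → Bool} {xs : List A} →
  All (λ x → p x ≡ q x) xs → count p xs ≡ count q xs
count-cong-All [] = refl
count-cong-All (eq ∷ eqs) = cong₂ _+_ (cong ind eq) (count-cong-All eqs)

count-false : {A : Set} (xs : List A) → count (λ _ → false) xs ≡ 0
count-false [] = refl
count-false (x ∷ xs) = count-false xs

count-guard : {A : Set} (c : Bool) (p : A → Bool) (xs : List A) →
  count (λ x → c ∧ p x) xs ≡ (if c then count p xs else 0)
count-guard true p xs = refl
count-guard false p xs = count-false xs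

count-mono : {p q : ℕ → Bool} (v : List ℕ) → (∀ z → T (p z) → T (q z)) → count p v ≤ count q v
count-mono [] _ = z≤n
count-mono (z ∷ v) p⇒q = +-mono-≤ (ind-mono (p⇒q z)) (count-mono v p⇒q)

count-+ : {p q s : ℕ → Bool} {v : List ℕ} → All (λ z → ind (p z) + ind (q z) ≡ ind (s z)) v →
  count p v + count q v ≡ count s v
count-+ [] = refl
count-+ {p} {q} {v = z ∷ v} (eq ∷ eqs) =
  trans (+-interchange (ind (p z)) (count p v) (ind (q z)) (count q v)) (cong₂ _+_ eq (count-+ eqs))

-- Finite sets of letters as decreasing lists

_∈ᵇ_ : ℕ → List ℕ → Bool
x ∈ᵇ [] = false
x ∈ᵇ (a ∷ A) = (x ≡ᵇ a) ∨ (x ∈ᵇ A)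

infix 7 _⊆ᵇ_
_⊆ᵇ_ : List ℕ → List ℕ → Bool
v ⊆ᵇ A = all (_∈ᵇ A) v

Decreasing : List ℕ → Set
Decreasing = AllPairs _>_

remove : ℕ → List ℕ → List ℕ
remove x [] = []
remove x (a ∷ A) = if x ≡ᵇ a then remove x A else a ∷ remove x A

∈ᵇ-All : ∀ {P : ℕ → Set} {x A} → All P A → T (x ∈ᵇ A) → P x
∈ᵇ-All {x = x} {a ∷ A} (pa ∷ pA) x∈A with x ≡ᵇ a | ≡ᵇ-reflects-≡ x a
... | true | ofʸ refl = pa
... | false | _ = ∈ᵇ-All pA x∈A

All-∈ᵇ : ∀ {P : ℕ → Set} A → (∀ x → T (x ∈ᵇ A) → P x) → All P A
All-∈ᵇ [] h = []
All-∈ᵇ (a ∷ A) h = h a (from T-∨ (inj₁ (≡⇒≡ᵇ a a refl)))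
                 ∷ All-∈ᵇ A (λ x x∈A → h x (from T-∨ (inj₂ x∈A)))

∉-All> : ∀ {a A} → All (_< a) A → (a ∈ᵇ A) ≡ false
∉-All> a>A = ¬T⇒≡false (λ a∈A → <-irrefl refl (∈ᵇ-All a>A a∈A))

remove-∉ : ∀ x A → (x ∈ᵇ A) ≡ false → remove x A ≡ A
remove-∉ x [] _ = refl
remove-∉ x (a ∷ A) x∉ with x ≡ᵇ a
... | false = cong (a ∷_) (remove-∉ x A x∉)

remove-All : ∀ {P : ℕ → Set} x {A} → All P A → All P (remove x A)
remove-All x [] = []
remove-All x {a ∷ A} (pa ∷ pA) with x ≡ᵇ a
... | true = remove-All x pA
... | false = pa ∷ remove-All x pA

remove-Decreasing : ∀ x {A} → Decreasing A → Decreasing (remove x A)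
remove-Decreasing x [] = []
remove-Decreasing x {a ∷ A} (a>A ∷ decA) with x ≡ᵇ a
... | true = remove-Decreasing x decA
... | false = remove-All x a>A ∷ remove-Decreasing x decA

∈ᵇ-remove : ∀ x y A → (y ∈ᵇ remove x A) ≡ (y ∈ᵇ A) ∧ not (x ≡ᵇ y)
∈ᵇ-remove x y [] = refl
∈ᵇ-remove x y (a ∷ A) with x ≡ᵇ a | ≡ᵇ-reflects-≡ x a
... | true | ofʸ refl with y ≡ᵇ x | ≡ᵇ-reflects-≡ y x
...   | true | ofʸ refl rewrite ≡ᵇ-refl y =
  trans (∈ᵇ-remove y y A) (trans (cong (λ b → (y ∈ᵇ A) ∧ not b) (≡ᵇ-refl y)) (∧-zeroʳ _))
...   | false | _ = ∈ᵇ-remove x y A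
∈ᵇ-remove x y (a ∷ A) | false | ofⁿ x≢a with y ≡ᵇ a | ≡ᵇ-reflects-≡ y a
...   | true | ofʸ refl rewrite ¬T⇒≡false (x≢a ∘ ≡ᵇ⇒≡ x y) = refl
...   | false | _ = ∈ᵇ-remove x y A

count-remove : ∀ p {A} a → Decreasing A → T (a ∈ᵇ A) → count p A ≡ ind (p a) + count p (remove a A)
count-remove p {c ∷ A} a (c>A ∷ decA) a∈A with a ≡ᵇ c | ≡ᵇ-reflects-≡ a c
... | true | ofʸ refl rewrite remove-∉ a A (∉-All> c>A) = refl
... | false | _ =
  trans (cong (ind (p c) +_) (count-remove p a decA a∈A)) (+-exchange (ind (p c)) (ind (p a)) _)

count-true : (A : List ℕ) → count (λ _ → true) A ≡ length A
count-true [] = refl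
count-true (a ∷ A) = cong suc (count-true A)

length-remove : ∀ {A} a → Decreasing A → T (a ∈ᵇ A) → length A ≡ suc (length (remove a A))
length-remove {A} a decA a∈A =
  trans (sym (count-true A)) (trans (count-remove _ a decA a∈A) (cong suc (count-true (remove a A))))

fresh : ℕ → List ℕ → Bool
fresh x = all (λ y → not (x ≡ᵇ y))

distinct : List ℕ → Bool
distinct [] = true
distinct (x ∷ v) = fresh x v ∧ distinct v

all-cong : {p q : ℕ → Bool} (v : List ℕ) → (∀ y → p y ≡ q y) → all p v ≡ all q v
all-cong [] eq = refl
all-cong (y ∷ v) eq = cong₂ _∧_ (eq y) (all-cong v eq)

all-∧ : (p q : ℕ → Bool) (v : List ℕ) → all p v ∧ all q v ≡ all (λ y → p y ∧ q y) v
all-∧ p q [] = refl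
all-∧ p q (y ∷ v) with p y | q y
... | true | true = all-∧ p q v
... | true | false = ∧-zeroʳ (all p v)
... | false | _ = refl

all-remove : ∀ x A (v : List ℕ) → v ⊆ᵇ A ∧ fresh x v ≡ v ⊆ᵇ remove x A
all-remove x A v = trans (all-∧ _ _ v) (all-cong v (λ y → sym (∈ᵇ-remove x y A)))

fresh⇒All≢ : ∀ y (v : List ℕ) → T (fresh y v) → All (λ z → ¬ y ≡ z) v
fresh⇒All≢ y [] _ = []
fresh⇒All≢ y (z ∷ v) t with to T-∧ t
... | y≢z , t′ = (λ y≡z → subst T (to T-not-≡ y≢z) (≡⇒≡ᵇ y z y≡z)) ∷ fresh⇒All≢ y v t′

count-rearrangement : ∀ p {B} (v : List ℕ) → Decreasing B → T (v ⊆ᵇ B) → T (distinct v) →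
  length v ≡ length B → count p v ≡ count p B
count-rearrangement p {[]} [] _ _ _ _ = refl
count-rearrangement p {b ∷ B} [] _ _ _ ()
count-rearrangement p {B} (y ∷ v) decB v⊆B distinct-v |v|≡|B| with to T-∧ v⊆B | to T-∧ distinct-v
... | y∈B , v⊆B′ | fresh-y , distinct-v′ = begin
  ind (p y) + count p v
    ≡⟨ cong (ind (p y) +_) (count-rearrangement p v (remove-Decreasing y decB)
         (subst T (all-remove y B v) (from T-∧ (v⊆B′ , fresh-y))) distinct-v′
         (suc-injective (trans |v|≡|B| (length-remove y decB y∈B)))) ⟩
  ind (p y) + count p (remove y B)
    ≡⟨ count-remove p y decB y∈B ⟨
  count p B ∎
  where open ≡-Reasoning

-- In a decreasing list the element at position i has exactly i larger elements.
sum-map-rank : ∀ (H : ℕ → ℕ) {A} → Decreasing A →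
  sum (map (λ a → H (count (a <ᵇ_) A)) A) ≡ ∑ (length A) (H ∘ toℕ)
sum-map-rank H [] = refl
sum-map-rank H {a ∷ A} (a>A ∷ decA) = cong₂ _+_ (cong H top-rank)
  (trans (cong sum (map-cong-local (All-map (λ {b} b<a → cong (λ c → H (ind c + count (b <ᵇ_) A)) (<ᵇ-true b<a))
                                             a>A)))
         (sum-map-rank (H ∘ suc) decA))
  where
  top-rank : ind (a <ᵇ a) + count (a <ᵇ_) A ≡ 0
  top-rank rewrite <ᵇ-false (≤-refl {a}) =
    trans (count-cong-All (All-map (λ b<a → <ᵇ-false (<⇒≤ b<a)) a>A)) (count-false A)

∑-indicator : ∀ n (J : ℕ → ℕ) {A} → Decreasing A → All (_< n) A →
  ∑ n (λ x → if toℕ x ∈ᵇ A then J (toℕ x) else 0) ≡ sum (map J A)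
∑-indicator n J [] [] = ∑-zero n
∑-indicator n J {a ∷ A} (a>A ∷ decA) (a<n ∷ A<n) = begin
  ∑ n (λ x → if toℕ x ∈ᵇ (a ∷ A) then J (toℕ x) else 0)
    ≡⟨ ∑-cong n split ⟩
  ∑ n (λ x → (if toℕ x ≡ᵇ a then J (toℕ x) else 0) + (if toℕ x ∈ᵇ A then J (toℕ x) else 0))
    ≡⟨ ∑-+ n _ _ ⟩
  ∑ n (λ x → if toℕ x ≡ᵇ a then J (toℕ x) else 0) + ∑ n (λ x → if toℕ x ∈ᵇ A then J (toℕ x) else 0)
    ≡⟨ cong₂ _+_ (∑-delta n a J a<n) (∑-indicator n J decA A<n) ⟩
  J a + sum (map J A) ∎
  where
  open ≡-Reasoning
  split : ∀ x → (if toℕ x ∈ᵇ (a ∷ A) then J (toℕ x) else 0)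
              ≡ (if toℕ x ≡ᵇ a then J (toℕ x) else 0) + (if toℕ x ∈ᵇ A then J (toℕ x) else 0)
  split x = if-∨-disjoint (toℕ x ≡ᵇ a) (J (toℕ x))
    (λ x≡a → subst (λ y → (y ∈ᵇ A) ≡ false) (sym (≡ᵇ⇒≡ _ a x≡a)) (∉-All> a>A))

downFrom-Decreasing : ∀ n → Decreasing (downFrom n)
downFrom-Decreasing zero = []
downFrom-Decreasing (suc n) = applyDownFrom⁺₁ (λ i → i) n (λ i<n → i<n) ∷ downFrom-Decreasing n

∈ᵇ-downFrom : ∀ {x n} → x < n → T (x ∈ᵇ downFrom n)
∈ᵇ-downFrom {x} {suc n} x<1+n with m≤n⇒m<n∨m≡n (s≤s⁻¹ x<1+n)
... | inj₁ x<n = from T-∨ (inj₂ (∈ᵇ-downFrom x<n))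
... | inj₂ refl = from T-∨ (inj₁ (≡⇒≡ᵇ x x refl))

pairs : (ℕ → ℕ → Bool) → List ℕ → ℕ
pairs Q [] = 0
pairs Q (y ∷ v) = count (Q y) v + pairs Q v

triples : (ℕ → ℕ → ℕ → Bool) → List ℕ → ℕ
triples P [] = 0
triples P (x ∷ v) = pairs (P x) v + triples P v

p123 : ℕ → ℕ → ℕ → Bool
p123 a b c = (a <ᵇ b) ∧ (b <ᵇ c)

p132 : ℕ → ℕ → ℕ → Bool
p132 a b c = (a <ᵇ c) ∧ (c <ᵇ b)

letters : ∀ {n k} → Vec (Fin n) k → List ℕ
letters w = tabulate (λ i → toℕ (lookup w i))

∑-count : ∀ k (p : ℕ → Bool) (g : Fin k → ℕ) → ∑ k (λ l → ind (p (g l))) ≡ count p (tabulate g)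
∑-count zero p g = refl
∑-count (suc k) p g = cong (ind (p (g fzero)) +_) (∑-count k p (g ∘ fsuc))

∑-pairs : ∀ k (Q : ℕ → ℕ → Bool) (g : Fin k → ℕ) →
  ∑ k (λ j → ∑ k (λ l → ind ((toℕ j <ᵇ toℕ l) ∧ Q (g j) (g l)))) ≡ pairs Q (tabulate g)
∑-pairs zero Q g = refl
∑-pairs (suc k) Q g = cong₂ _+_ (∑-count k (Q (g fzero)) (g ∘ fsuc)) (∑-pairs k Q (g ∘ fsuc))

∑-triples : ∀ k (P : ℕ → ℕ → ℕ → Bool) (g : Fin k → ℕ) →
  ∑ k (λ i → ∑ k (λ j → ∑ k (λ l → ind ((toℕ i <ᵇ toℕ j) ∧ (toℕ j <ᵇ toℕ l) ∧ P (g i) (g j) (g l)))))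
    ≡ triples P (tabulate g)
∑-triples zero P g = refl
∑-triples (suc k) P g = cong₂ _+_
  (cong₂ _+_ (∑-zero (suc k)) (∑-pairs k (P (g fzero)) (g ∘ fsuc)))
  (trans (∑-cong k later-rows) (∑-triples k P (g ∘ fsuc)))
  where
  entry : Fin k → Fin k → Fin k → ℕ
  entry i j l = ind ((toℕ i <ᵇ toℕ j) ∧ (toℕ j <ᵇ toℕ l) ∧ P (g (fsuc i)) (g (fsuc j)) (g (fsuc l)))
  -- Past the first row, the terms with j = 0 or l = 0 vanish.
  later-rows : ∀ i →
    ∑ (suc k) (λ j → ∑ (suc k) (λ l → ind ((toℕ (fsuc i) <ᵇ toℕ j) ∧ (toℕ j <ᵇ toℕ l) ∧ P (g (fsuc i)) (g j) (g l))))
      ≡ ∑ k (λ j → ∑ k (λ l → entry i j l))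
  later-rows i = cong₂ _+_ (∑-zero (suc k))
    (∑-cong k (λ j → cong (λ b → ind b + ∑ k (λ l → entry i j l)) (∧-zeroʳ (toℕ i <ᵇ toℕ j))))

countTriples≡triples : ∀ P {n} (w : Vec (Fin n) n) → countTriples P w ≡ triples P (letters w)
countTriples≡triples P {n} w =
  trans (sum-map-allFin n _)
        (trans (∑-cong n (λ i → trans (sum-map-allFin n _) (∑-cong n (λ j → sum-map-allFin n _))))
               (∑-triples n P (λ i → toℕ (lookup w i))))

and-fresh : ∀ k x (g : Fin k → ℕ) →
  and (tabulate (λ j → if x ≡ᵇ g j then false else true)) ≡ fresh x (tabulate g)
and-fresh zero x g = refl
and-fresh (suc k) x g = cong₂ _∧_ (if-then-false-else-true (x ≡ᵇ g fzero)) (and-fresh k x (g ∘ fsuc))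

and-distinct : ∀ k (g : Fin k → ℕ) →
  and (tabulate (λ i → and (tabulate (λ j →
    if toℕ i <ᵇ toℕ j then (if g i ≡ᵇ g j then false else true) else true))))
    ≡ distinct (tabulate g)
and-distinct zero g = refl
and-distinct (suc k) g = cong₂ _∧_ (and-fresh k (g fzero) (g ∘ fsuc)) (and-distinct k (g ∘ fsuc))

isPerm≡distinct : ∀ {n} (w : Vec (Fin n) n) → isPerm w ≡ distinct (letters w)
isPerm≡distinct {n} w =
  trans (cong and (map-tabulate (λ i → i) row))
        (trans (cong and (tabulate-cong (λ i → cong and (map-tabulate (λ j → j) (entry i)))))
               (and-distinct n g))
  where
  g : Fin n → ℕ
  g i = toℕ (lookup w i)
  entry : Fin n → Fin n → Bool
  entry i j = if toℕ i <ᵇ toℕ j then (if g i ≡ᵇ g j then false else true) else true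
  row : Fin n → Bool
  row i = all (entry i) (allFin n)

pairs-mono : {Q Q′ : ℕ → ℕ → Bool} (v : List ℕ) → (∀ y z → T (Q y z) → T (Q′ y z)) →
  pairs Q v ≤ pairs Q′ v
pairs-mono [] _ = z≤n
pairs-mono (y ∷ v) Q⇒Q′ = +-mono-≤ (count-mono v (Q⇒Q′ y)) (pairs-mono v Q⇒Q′)

choose2 : ℕ → ℕ
choose2 zero = 0
choose2 (suc t) = t + choose2 t

pairs-from-top : ∀ x (Q : ℕ → ℕ → Bool) (v : List ℕ) → (∀ y z → T (Q y z) → T (x <ᵇ y)) →
  count (x <ᵇ_) v ≡ 0 → pairs Q v ≡ 0
pairs-from-top x Q [] _ _ = refl
pairs-from-top x Q (y ∷ v) Q⇒x<y none-above = cong₂ _+_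
  (trans (count-cong v (λ z → ¬T⇒≡false (x≮y ∘ Q⇒x<y y z))) (count-false v))
  (pairs-from-top x Q v Q⇒x<y (m+n≡0⇒n≡0 (ind (x <ᵇ y)) none-above))
  where
  x≮y : ¬ T (x <ᵇ y)
  x≮y = ind≡0⇒¬T (m+n≡0⇒m≡0 (ind (x <ᵇ y)) none-above)

p123⇒< : ∀ x y z → T (p123 x y z) → T (x <ᵇ y)
p123⇒< x y z t = proj₁ (to T-∧ t)

p132⇒< : ∀ x y z → T (p132 x y z) → T (x <ᵇ y)
p132⇒< x y z t with to T-∧ t
... | x<z , z<y = <⇒<ᵇ (<-trans (<ᵇ⇒< x z x<z) (<ᵇ⇒< z y z<y))

-- Behind a letter y > x, every later z ≠ y above x completes either x y z to a 123 or x z y to a 132.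
split-above : ∀ {x y} z → x < y → ¬ y ≡ z → ind (p123 x y z) + ind (p132 x y z) ≡ ind (x <ᵇ z)
split-above {x} {y} z x<y y≢z rewrite <ᵇ-true x<y with y <ᵇ z | <ᵇ-reflects-< y z
... | true | ofʸ y<z rewrite <ᵇ-true (<-trans x<y y<z) | <ᵇ-false {z} (<⇒≤ y<z) = refl
... | false | ofⁿ y≮z with z <ᵇ y | <ᵇ-reflects-< z y
...   | true | _ = cong ind (∧-identityʳ (x <ᵇ z))
...   | false | ofⁿ z≮y = ⊥-elim (y≢z (≤-antisym (≮⇒≥ z≮y) (≮⇒≥ y≮z)))

pairs132≡choose2 : ∀ x (v : List ℕ) → T (distinct v) → pairs (p123 x) v ≡ 0 →
  pairs (p132 x) v ≡ choose2 (count (x <ᵇ_) v)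
pairs132≡choose2 x [] _ _ = refl
pairs132≡choose2 x (y ∷ v) distinct-yv no123 with to T-∧ distinct-yv | x <ᵇ y | <ᵇ-reflects-< x y
... | fresh-y , distinct-v | true | ofʸ x<y = cong₂ _+_ as-count
      (pairs132≡choose2 x v distinct-v (m+n≡0⇒n≡0 (count (p123 x y) v) no123))
  where
  as-count : count (p132 x y) v ≡ count (x <ᵇ_) v
  as-count = trans (sym (cong (_+ count (p132 x y) v) (m+n≡0⇒m≡0 (count (p123 x y) v) no123)))
                   (count-+ (All-map (λ {z} → split-above z x<y) (fresh⇒All≢ y v fresh-y)))
... | _ , distinct-v | false | ofⁿ x≮y = cong₂ _+_
      (trans (count-cong v (λ z → ¬T⇒≡false (x≮y ∘ <ᵇ⇒< x y ∘ p132⇒< x y z))) (count-false v))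
      (pairs132≡choose2 x v distinct-v (m+n≡0⇒n≡0 (count (p123 x y) v) no123))

-- The left-to-right scan

below : Maybe ℕ → ℕ → Bool
below nothing x = false
below (just b) x = b <ᵇ x

-- r is the number of 132's still to be produced, b the current minimum (nothing before the first
-- letter) and c the number of later letters above x.
mutual
  scan : ℕ → Maybe ℕ → List ℕ → Bool
  scan r b [] = r ≡ᵇ 0
  scan r b (x ∷ v) = fresh x v ∧ scanStep r b x (count (x <ᵇ_) v) v

  scanStep : ℕ → Maybe ℕ → ℕ → ℕ → List ℕ → Bool
  scanStep r b x c v = if below b x then (c ≡ᵇ 0) ∧ scan r b v
                       else (choose2 c ≤ᵇ r) ∧ scan (r ∸ choose2 c) (just x) v

noAscentFrom : Maybe ℕ → List ℕ → Bool
noAscentFrom nothing v = true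
noAscentFrom (just b) v = pairs (p123 b) v ≡ᵇ 0

target : ℕ → Maybe ℕ → List ℕ → Bool
target r b v = distinct v ∧ (triples p123 v ≡ᵇ 0) ∧ (triples p132 v ≡ᵇ r) ∧ noAscentFrom b v

Target : ℕ → Maybe ℕ → List ℕ → Set
Target r b v = T (distinct v) × triples p123 v ≡ 0 × triples p132 v ≡ r × T (noAscentFrom b v)

T-target : ∀ r b v → T (target r b v) ⇔ Target r b v
T-target r b v = mk⇔
  (λ t → let d , t₁ = to T-∧ t; e₁ , t₂ = to T-∧ t₁; e₂ , na = to T-∧ t₂
         in d , ≡ᵇ⇒≡ _ 0 e₁ , ≡ᵇ⇒≡ _ r e₂ , na)
  (λ (d , e₁ , e₂ , na) → from T-∧ (d , from T-∧ (≡⇒≡ᵇ _ 0 e₁ , from T-∧ (≡⇒≡ᵇ _ r e₂ , na))))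

count-p123-below : ∀ b x (v : List ℕ) → b < x → count (p123 b x) v ≡ count (x <ᵇ_) v
count-p123-below b x v b<x = count-cong v (λ z → cong (_∧ (x <ᵇ z)) (<ᵇ-true b<x))

target-below : ∀ r b x v → T (below b x) →
  target r b (x ∷ v) ≡ fresh x v ∧ (count (x <ᵇ_) v ≡ᵇ 0) ∧ target r b v
target-below r (just b) x v b<ᵇx =
  T-injective (forward ∘ to (T-target r (just b) (x ∷ v)))
    (λ t → let fresh-x , t₁ = to T-∧ t; c≡ᵇ0 , t₂ = to T-∧ t₁
           in from (T-target r (just b) (x ∷ v))
                   (backward fresh-x (≡ᵇ⇒≡ c 0 c≡ᵇ0) (to (T-target r (just b) v) t₂)))
  where
  b<x : b < x
  b<x = <ᵇ⇒< b x b<ᵇx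
  c = count (x <ᵇ_) v
  pb = pairs (p123 b) v
  vanish : c ≡ 0 → pairs (p123 x) v ≡ 0 × pairs (p132 x) v ≡ 0
  vanish c≡0 = pairs-from-top x _ v (p123⇒< x) c≡0 , pairs-from-top x _ v (p132⇒< x) c≡0
  forward : Target r (just b) (x ∷ v) → T (fresh x v ∧ (c ≡ᵇ 0) ∧ target r (just b) v)
  forward (d , no123 , r132 , na) = from T-∧ (fresh-x , from T-∧ (≡⇒≡ᵇ c 0 c≡0 ,
      from (T-target r (just b) v) (distinct-v ,
        trans (cong (_+ triples p123 v) (sym (proj₁ (vanish c≡0)))) no123 ,
        trans (cong (_+ triples p132 v) (sym (proj₂ (vanish c≡0)))) r132 ,
        ≡⇒≡ᵇ pb 0 (m+n≡0⇒n≡0 c c+pb≡0))))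
    where
    fresh-x : T (fresh x v)
    fresh-x = proj₁ (to T-∧ d)
    distinct-v : T (distinct v)
    distinct-v = proj₂ (to T-∧ d)
    c+pb≡0 : c + pb ≡ 0
    c+pb≡0 = trans (cong (_+ pb) (sym (count-p123-below b x v b<x))) (≡ᵇ⇒≡ _ 0 na)
    c≡0 : c ≡ 0
    c≡0 = m+n≡0⇒m≡0 c c+pb≡0
  backward : T (fresh x v) → c ≡ 0 → Target r (just b) v → Target r (just b) (x ∷ v)
  backward fresh-x c≡0 (distinct-v , no123 , r132 , na) =
    from T-∧ (fresh-x , distinct-v) ,
    cong₂ _+_ (proj₁ (vanish c≡0)) no123 ,
    trans (cong (_+ triples p132 v) (proj₂ (vanish c≡0))) r132 ,
    ≡⇒≡ᵇ _ 0 (cong₂ _+_ (trans (count-p123-below b x v b<x) c≡0) (≡ᵇ⇒≡ pb 0 na))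

noAscentFrom-min : ∀ b x v → ¬ T (below b x) → pairs (p123 x) v ≡ 0 → T (noAscentFrom b (x ∷ v))
noAscentFrom-min nothing x v _ _ = tt
noAscentFrom-min (just b) x v b≮x no123-x = ≡⇒≡ᵇ _ 0 (cong₂ _+_ no123-bx no123-b)
  where
  x≤b : x ≤ b
  x≤b = ≮⇒≥ (b≮x ∘ <⇒<ᵇ)
  no123-bx : count (p123 b x) v ≡ 0
  no123-bx = trans (count-cong v (λ z → cong (_∧ (x <ᵇ z)) (¬T⇒≡false b≮x))) (count-false v)
  lower-first : ∀ y z → T (p123 b y z) → T (p123 x y z)
  lower-first y z t = from T-∧ (<⇒<ᵇ (≤-<-trans x≤b (<ᵇ⇒< b y (proj₁ (to T-∧ t)))) , proj₂ (to T-∧ t))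
  no123-b : pairs (p123 b) v ≡ 0
  no123-b = n≤0⇒n≡0 (≤-trans (pairs-mono v lower-first) (≤-reflexive no123-x))

target-min : ∀ r b x v → ¬ T (below b x) →
  target r b (x ∷ v)
    ≡ fresh x v ∧ (choose2 (count (x <ᵇ_) v) ≤ᵇ r) ∧ target (r ∸ choose2 (count (x <ᵇ_) v)) (just x) v
target-min r b x v b≮x =
  T-injective (forward ∘ to (T-target r b (x ∷ v)))
    (λ t → let fresh-x , t₁ = to T-∧ t; fits , t₂ = to T-∧ t₁
           in from (T-target r b (x ∷ v))
                   (backward fresh-x (≤ᵇ⇒≤ _ r fits) (to (T-target (r ∸ k) (just x) v) t₂)))
  where
  k = choose2 (count (x <ᵇ_) v)
  forward : Target r b (x ∷ v) → T (fresh x v ∧ (k ≤ᵇ r) ∧ target (r ∸ k) (just x) v)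
  forward (d , no123 , r132 , _) = from T-∧ (fresh-x , from T-∧ (≤⇒≤ᵇ k≤r ,
      from (T-target (r ∸ k) (just x) v) (distinct-v , m+n≡0⇒n≡0 _ no123 , rest132 , ≡⇒≡ᵇ _ 0 no123-x)))
    where
    fresh-x : T (fresh x v)
    fresh-x = proj₁ (to T-∧ d)
    distinct-v : T (distinct v)
    distinct-v = proj₂ (to T-∧ d)
    no123-x : pairs (p123 x) v ≡ 0
    no123-x = m+n≡0⇒m≡0 _ no123
    k+rest≡r : k + triples p132 v ≡ r
    k+rest≡r = trans (cong (_+ triples p132 v) (sym (pairs132≡choose2 x v distinct-v no123-x))) r132
    k≤r : k ≤ r
    k≤r = subst (k ≤_) k+rest≡r (m≤m+n k _)
    rest132 : triples p132 v ≡ r ∸ k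
    rest132 = trans (sym (m+n∸m≡n k _)) (cong (_∸ k) k+rest≡r)
  backward : T (fresh x v) → k ≤ r → Target (r ∸ k) (just x) v → Target r b (x ∷ v)
  backward fresh-x k≤r (distinct-v , no123 , rest132 , na) =
    from T-∧ (fresh-x , distinct-v) ,
    cong₂ _+_ no123-x no123 ,
    trans (cong₂ _+_ (pairs132≡choose2 x v distinct-v no123-x) rest132) (m+[n∸m]≡n k≤r) ,
    noAscentFrom-min b x v b≮x no123-x
    where
    no123-x : pairs (p123 x) v ≡ 0
    no123-x = ≡ᵇ⇒≡ _ 0 na

scanStep-below : ∀ r b x c v → T (below b x) → scanStep r b x c v ≡ (c ≡ᵇ 0) ∧ scan r b v
scanStep-below r b x c v h rewrite T⇒≡true h = refl

scanStep-min : ∀ r b x c v → ¬ T (below b x) →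
  scanStep r b x c v ≡ (choose2 c ≤ᵇ r) ∧ scan (r ∸ choose2 c) (just x) v
scanStep-min r b x c v h rewrite ¬T⇒≡false h = refl

target≡scan : ∀ r b v → target r b v ≡ scan r b v
target≡scan zero nothing [] = refl
target≡scan zero (just b) [] = refl
target≡scan (suc r) nothing [] = refl
target≡scan (suc r) (just b) [] = refl
target≡scan r b (x ∷ v) with T? (below b x)
... | yes below = trans (target-below r b x v below)
  (cong (fresh x v ∧_) (trans (cong ((c ≡ᵇ 0) ∧_) (target≡scan r b v))
                              (sym (scanStep-below r b x c v below))))
  where c = count (x <ᵇ_) v
... | no ¬below = trans (target-min r b x v ¬below)
  (cong (fresh x v ∧_) (trans (cong ((k ≤ᵇ r) ∧_) (target≡scan (r ∸ k) (just x) v))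
                              (sym (scanStep-min r b x c v ¬below))))
  where c = count (x <ᵇ_) v
        k = choose2 c

scan-distinct : ∀ r b v → T (scan r b v) → T (distinct v)
scan-distinct r b v t = proj₁ (to (T-target r b v) (subst T (sym (target≡scan r b v)) t))

scanStep-distinct : ∀ r b x c v → T (scanStep r b x c v) → T (distinct v)
scanStep-distinct r b x c v t with below b x
... | true = scan-distinct r b v (proj₂ (to T-∧ t))
... | false = scan-distinct (r ∸ choose2 c) (just x) v (proj₂ (to T-∧ t))

count-words-suc : ∀ n k (Q : List ℕ → Bool) →
  count (Q ∘ letters) (words n (suc k)) ≡ ∑ n (λ a → count (λ w → Q (toℕ a ∷ letters w)) (words n k))
count-words-suc n k Q =
  trans (count-concatMap (Q ∘ letters) (λ a → map (a ∷_) (words n k)) (allFin n))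
        (trans (cong sum (map-cong (λ a → count-map (Q ∘ letters) (a ∷_) (words n k)) (allFin n)))
               (sum-map-allFin n _))

#above : Maybe ℕ → List ℕ → ℕ
#above nothing A = 0
#above (just b) A = count (b <ᵇ_) A

branch : {X : Set} → X → (ℕ → ℕ → X) → ℕ → ℕ → ℕ → X
branch o G r m t = if t <ᵇ m then (if t ≡ᵇ 0 then G r (m ∸ 1) else o)
                   else (if choose2 t ≤ᵇ r then G (r ∸ choose2 t) t else o)

-- completions k r m: k letters left, r occurrences of 132 to go and m of the remaining letters above
-- the current minimum; t is the number of remaining letters above the next one.
completions : ℕ → ℕ → ℕ → ℕ
completions zero r m = ind (r ≡ᵇ 0)
completions (suc k) r m = ∑ (suc k) (λ t → branch 0 (completions k) r m (toℕ t))

#scans : (n k r : ℕ) → Maybe ℕ → List ℕ → ℕ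
#scans n k r b A = count (λ w → letters w ⊆ᵇ A ∧ scan r b (letters w)) (words n k)

ScanCount : ℕ → ℕ → Set
ScanCount n k = ∀ r b {A} → Decreasing A → All (_< n) A → length A ≡ k →
  #scans n k r b A ≡ completions k r (#above b A)

branch-below : ∀ {X : Set} {o : X} {G r m t} → t < m → branch o G r m t ≡ (if t ≡ᵇ 0 then G r (m ∸ 1) else o)
branch-below t<m rewrite <ᵇ-true t<m = refl

branch-min : ∀ {X : Set} {o : X} {G r m t} → m ≤ t →
  branch o G r m t ≡ (if choose2 t ≤ᵇ r then G (r ∸ choose2 t) t else o)
branch-min m≤t rewrite <ᵇ-false m≤t = refl

#above-remove-below : ∀ b {A} a → Decreasing A → T (a ∈ᵇ A) → T (below b a) →
  #above b A ≡ suc (#above b (remove a A))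
#above-remove-below (just b) {A} a decA a∈A b<a =
  trans (count-remove (b <ᵇ_) a decA a∈A) (cong (λ β → ind β + count (b <ᵇ_) (remove a A)) (T⇒≡true b<a))

rank≤#above : ∀ b a B → T (below b a) → count (a <ᵇ_) B ≤ #above b B
rank≤#above (just b) a B b<a = count-mono B (λ z a<z → <⇒<ᵇ (<-trans (<ᵇ⇒< b a b<a) (<ᵇ⇒< a z a<z)))

#above≤rank : ∀ b a A → ¬ T (below b a) → #above b A ≤ count (a <ᵇ_) A
#above≤rank nothing a A _ = z≤n
#above≤rank (just b) a A b≮a =
  count-mono A (λ z b<z → <⇒<ᵇ (≤-<-trans (≮⇒≥ (b≮a ∘ <⇒<ᵇ)) (<ᵇ⇒< b z b<z)))

-- Once the remaining letters B are fixed, the number of later letters above a is determined by B.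
#scans-rank : ∀ n k r b a t {B} → Decreasing B → length B ≡ k → count (a <ᵇ_) B ≡ t →
  count (λ w → letters w ⊆ᵇ B ∧ scanStep r b a (count (a <ᵇ_) (letters w)) (letters w)) (words n k)
    ≡ count (λ w → letters w ⊆ᵇ B ∧ scanStep r b a t (letters w)) (words n k)
#scans-rank n k r b a t {B} decB |B|≡k rank = count-cong (words n k) λ w →
  ∧-congʳ-under (letters w ⊆ᵇ B)
    (λ w⊆B s → cong (λ c → scanStep r b a c (letters w))
                    (rank-of w w⊆B (scanStep-distinct r b a (count (a <ᵇ_) (letters w)) (letters w) s)))
    (λ w⊆B s → cong (λ c → scanStep r b a c (letters w)) (rank-of w w⊆B (scanStep-distinct r b a t (letters w) s)))
  where
  rank-of : (w : Vec (Fin n) k) → T (letters w ⊆ᵇ B) → T (distinct (letters w)) → count (a <ᵇ_) (letters w) ≡ t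
  rank-of w w⊆B d =
    trans (count-rearrangement (a <ᵇ_) (letters w) decB w⊆B d (trans (length-tabulate _) (sym |B|≡k))) rank

#scanStep-below : ∀ n k r b a t {B} → ScanCount n k → Decreasing B → All (_< n) B → length B ≡ k →
  T (below b a) →
  count (λ w → letters w ⊆ᵇ B ∧ scanStep r b a t (letters w)) (words n k)
    ≡ (if t ≡ᵇ 0 then completions k r (#above b B) else 0)
#scanStep-below n k r b a t {B} IH decB B<n |B|≡k below = begin
  count (λ w → letters w ⊆ᵇ B ∧ scanStep r b a t (letters w)) (words n k)
    ≡⟨ count-cong (words n k) (λ w → trans (cong (letters w ⊆ᵇ B ∧_) (scanStep-below r b a t (letters w) below))
                                          (∧-swapˡ (letters w ⊆ᵇ B) (t ≡ᵇ 0) (scan r b (letters w)))) ⟩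
  count (λ w → (t ≡ᵇ 0) ∧ (letters w ⊆ᵇ B ∧ scan r b (letters w))) (words n k)
    ≡⟨ count-guard (t ≡ᵇ 0) _ (words n k) ⟩
  (if t ≡ᵇ 0 then #scans n k r b B else 0)
    ≡⟨ cong (λ N → if t ≡ᵇ 0 then N else 0) (IH r b decB B<n |B|≡k) ⟩
  (if t ≡ᵇ 0 then completions k r (#above b B) else 0) ∎
  where open ≡-Reasoning

#scanStep-min : ∀ n k r b a t {B} → ScanCount n k → Decreasing B → All (_< n) B → length B ≡ k →
  ¬ T (below b a) →
  count (λ w → letters w ⊆ᵇ B ∧ scanStep r b a t (letters w)) (words n k)
    ≡ (if choose2 t ≤ᵇ r then completions k (r ∸ choose2 t) (count (a <ᵇ_) B) else 0)
#scanStep-min n k r b a t {B} IH decB B<n |B|≡k ¬below = begin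
  count (λ w → letters w ⊆ᵇ B ∧ scanStep r b a t (letters w)) (words n k)
    ≡⟨ count-cong (words n k) (λ w → trans (cong (letters w ⊆ᵇ B ∧_) (scanStep-min r b a t (letters w) ¬below))
                                          (∧-swapˡ (letters w ⊆ᵇ B) (c ≤ᵇ r) (scan (r ∸ c) (just a) (letters w)))) ⟩
  count (λ w → (c ≤ᵇ r) ∧ (letters w ⊆ᵇ B ∧ scan (r ∸ c) (just a) (letters w))) (words n k)
    ≡⟨ count-guard (c ≤ᵇ r) _ (words n k) ⟩
  (if c ≤ᵇ r then #scans n k (r ∸ c) (just a) B else 0)
    ≡⟨ cong (λ N → if c ≤ᵇ r then N else 0) (IH (r ∸ c) (just a) decB B<n |B|≡k) ⟩
  (if c ≤ᵇ r then completions k (r ∸ c) (count (a <ᵇ_) B) else 0) ∎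
  where
  open ≡-Reasoning
  c = choose2 t

#scans-first : ∀ n k r b {A} a → ScanCount n k → Decreasing A → All (_< n) A → length A ≡ suc k →
  T (a ∈ᵇ A) →
  count (λ w → letters w ⊆ᵇ remove a A ∧ scanStep r b a (count (a <ᵇ_) (letters w)) (letters w)) (words n k)
    ≡ branch 0 (completions k) r (#above b A) (count (a <ᵇ_) A)
#scans-first n k r b {A} a IH decA A<n |A|≡1+k a∈A =
  trans (#scans-rank n k r b a t decB |B|≡k rank-a) (by-case (T? (below b a)))
  where
  B = remove a A
  decB : Decreasing B
  decB = remove-Decreasing a decA
  |B|≡k : length B ≡ k
  |B|≡k = suc-injective (trans (sym (length-remove a decA a∈A)) |A|≡1+k)
  t = count (a <ᵇ_) A
  rank-a : count (a <ᵇ_) B ≡ t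
  rank-a = sym (trans (count-remove (a <ᵇ_) a decA a∈A)
                      (cong (λ β → ind β + count (a <ᵇ_) B) (<ᵇ-false (≤-refl {a}))))
  by-case : Dec (T (below b a)) →
    count (λ w → letters w ⊆ᵇ B ∧ scanStep r b a t (letters w)) (words n k)
      ≡ branch 0 (completions k) r (#above b A) t
  by-case (yes below) = trans (#scanStep-below n k r b a t IH decB (remove-All a A<n) |B|≡k below)
    (trans (sym (branch-below {o = 0} {completions k} {r} {suc (#above b B)} {t}
                  (s≤s (subst (_≤ #above b B) rank-a (rank≤#above b a B below)))))
           (cong (λ m → branch 0 (completions k) r m t) (sym (#above-remove-below b a decA a∈A below))))
  by-case (no ¬below) = trans (#scanStep-min n k r b a t IH decB (remove-All a A<n) |B|≡k ¬below)
    (trans (cong (λ m → if choose2 t ≤ᵇ r then completions k (r ∸ choose2 t) m else 0) rank-a)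
           (sym (branch-min {o = 0} {completions k} {r} {#above b A} {t} (#above≤rank b a A ¬below))))

count-scan : ∀ n k → ScanCount n k
count-scan n zero r b {[]} [] [] refl = +-identityʳ (ind (r ≡ᵇ 0))
count-scan n (suc k) r b {A} decA A<n |A|≡1+k = begin
  #scans n (suc k) r b A
    ≡⟨ count-words-suc n k (λ L → L ⊆ᵇ A ∧ scan r b L) ⟩
  ∑ n (λ a → count (λ w → (toℕ a ∷ letters w) ⊆ᵇ A ∧ scan r b (toℕ a ∷ letters w)) (words n k))
    ≡⟨ ∑-cong n (λ a → first-letter (toℕ a)) ⟩
  ∑ n (λ a → if toℕ a ∈ᵇ A then J (toℕ a) else 0)
    ≡⟨ ∑-indicator n J decA A<n ⟩
  sum (map J A)
    ≡⟨ cong sum (map-cong-local (All-∈ᵇ A (λ a → #scans-first n k r b a (count-scan n k) decA A<n |A|≡1+k))) ⟩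
  sum (map (λ a → branch 0 (completions k) r (#above b A) (count (a <ᵇ_) A)) A)
    ≡⟨ sum-map-rank (branch 0 (completions k) r (#above b A)) decA ⟩
  ∑ (length A) (λ t → branch 0 (completions k) r (#above b A) (toℕ t))
    ≡⟨ cong (λ l → ∑ l (λ t → branch 0 (completions k) r (#above b A) (toℕ t))) |A|≡1+k ⟩
  completions (suc k) r (#above b A) ∎
  where
  open ≡-Reasoning
  J : ℕ → ℕ
  J a = count (λ w → letters w ⊆ᵇ remove a A ∧ scanStep r b a (count (a <ᵇ_) (letters w)) (letters w))
              (words n k)
  first-letter : ∀ a → count (λ w → (a ∷ letters w) ⊆ᵇ A ∧ scan r b (a ∷ letters w)) (words n k)
                         ≡ (if a ∈ᵇ A then J a else 0)
  first-letter a = trans (count-cong (words n k) regroup) (count-guard (a ∈ᵇ A) _ (words n k))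
    where
    regroup : ∀ w → (a ∷ letters w) ⊆ᵇ A ∧ scan r b (a ∷ letters w)
                    ≡ (a ∈ᵇ A) ∧ (letters w ⊆ᵇ remove a A ∧ scanStep r b a (count (a <ᵇ_) (letters w)) (letters w))
    regroup w = trans (∧-assoc (a ∈ᵇ A) _ _)
                  (cong ((a ∈ᵇ A) ∧_) (trans (sym (∧-assoc (letters w ⊆ᵇ A) (fresh a (letters w)) _))
                                             (cong (_∧ _) (all-remove a A (letters w)))))

letters-in-range : ∀ {n k} (w : Vec (Fin n) k) → letters w ⊆ᵇ downFrom n ≡ true
letters-in-range [] = refl
letters-in-range (a ∷ w) = cong₂ _∧_ (T⇒≡true (∈ᵇ-downFrom (toℕ<n a))) (letters-in-range w)

isTarget≡scan : ∀ {n} (w : Vec (Fin n) n) → isTarget w ≡ letters w ⊆ᵇ downFrom n ∧ scan 3 nothing (letters w)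
isTarget≡scan {n} w = begin
  isTarget w
    ≡⟨ cong₂ _∧_ (isPerm≡distinct w) (cong₂ _∧_ (cong (_≡ᵇ 0) (countTriples≡triples p123 w))
         (trans (cong (_≡ᵇ 3) (countTriples≡triples p132 w)) (sym (∧-identityʳ _)))) ⟩
  target 3 nothing (letters w)
    ≡⟨ target≡scan 3 nothing (letters w) ⟩
  scan 3 nothing (letters w)
    ≡⟨ cong (_∧ scan 3 nothing (letters w)) (letters-in-range w) ⟨
  letters w ⊆ᵇ downFrom n ∧ scan 3 nothing (letters w) ∎
  where open ≡-Reasoning

countTarget≡completions : ∀ n → countTarget n ≡ completions n 3 0
countTarget≡completions n =
  trans (length-filter isTarget (words n n))
        (trans (count-cong (words n n) isTarget≡scan)
               (count-scan n n 3 nothing (downFrom-Decreasing n) (applyDownFrom⁺₁ (λ i → i) n (λ i<n → i<n))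
                           (length-downFrom n)))

-- Solving the recurrence

∑-truncate : ∀ a k (H : ℕ → ℕ) → (∀ t → H (a + t) ≡ 0) → ∑ (a + k) (H ∘ toℕ) ≡ ∑ a (H ∘ toℕ)
∑-truncate zero k H h = trans (∑-cong k (h ∘ toℕ)) (∑-zero k)
∑-truncate (suc a) k H h = cong (H 0 +_) (∑-truncate a k (H ∘ suc) h)

3<choose2 : ∀ t → 3 < choose2 (4 + t)
3<choose2 zero = m≤m+n 4 2
3<choose2 (suc t) = ≤-trans (3<choose2 t) (m≤n+m _ (4 + t))

branch-beyond : ∀ {X : Set} {o : X} {G r m t} → m ≤ t → r < choose2 t → branch o G r m t ≡ o
branch-beyond {t = t} m≤t r<c rewrite <ᵇ-false m≤t | ¬T⇒≡false (<⇒≱ r<c ∘ ≤ᵇ⇒≤ (choose2 t) _) = refl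

completions-truncate : ∀ k r m → r ≤ 3 → m ≤ 3 →
  completions (4 + k) r m ≡ ∑ 4 (λ t → branch 0 (completions (3 + k)) r m (toℕ t))
completions-truncate k r m r≤3 m≤3 = ∑-truncate 4 k (branch 0 (completions (3 + k)) r m)
  (λ t → branch-beyond {o = 0} {completions (3 + k)} (≤-trans m≤3 (m≤m+n 3 (suc t)))
                                                     (≤-<-trans r≤3 (3<choose2 t)))

Poly : Set
Poly = Vec ℕ 4

⟦_⟧ : Poly → ℕ → ℕ
⟦ a ∷ b ∷ c ∷ d ∷ [] ⟧ j = a + b * j + c * (j C 2) + d * (j C 3)

𝟘 : Poly
𝟘 = 0 ∷ 0 ∷ 0 ∷ 0 ∷ []

_⊕_ : Poly → Poly → Poly
_⊕_ = zipWith _+_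

_·_ : ℕ → Poly → Poly
k · p = Vec.map (k *_) p

shift : Poly → Poly
shift (a ∷ b ∷ c ∷ d ∷ []) = (a + b) ∷ (b + c) ∷ (c + d) ∷ d ∷ []

⨁ : (k : ℕ) → (Fin k → Poly) → Poly
⨁ zero f = 𝟘
⨁ (suc k) f = f fzero ⊕ ⨁ k (f ∘ fsuc)

⟦⟧-⊕ : ∀ p q j → ⟦ p ⊕ q ⟧ j ≡ ⟦ p ⟧ j + ⟦ q ⟧ j
⟦⟧-⊕ (a ∷ b ∷ c ∷ d ∷ []) (a′ ∷ b′ ∷ c′ ∷ d′ ∷ []) j =
  distrib a b c d a′ b′ c′ d′ j (j C 2) (j C 3)
  where
  distrib : ∀ a b c d a′ b′ c′ d′ x y z →
    a + a′ + (b + b′) * x + (c + c′) * y + (d + d′) * z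
      ≡ a + b * x + c * y + d * z + (a′ + b′ * x + c′ * y + d′ * z)
  distrib = solve-∀

⟦⟧-· : ∀ k p j → ⟦ k · p ⟧ j ≡ k * ⟦ p ⟧ j
⟦⟧-· k (a ∷ b ∷ c ∷ d ∷ []) j = distrib k a b c d j (j C 2) (j C 3)
  where
  distrib : ∀ k a b c d x y z → k * a + k * b * x + k * c * y + k * d * z ≡ k * (a + b * x + c * y + d * z)
  distrib = solve-∀

-- By Pascal's rule C(j + 1, i) = C(j, i - 1) + C(j, i).
⟦⟧-suc : ∀ p j → ⟦ p ⟧ (suc j) ≡ ⟦ shift p ⟧ j
⟦⟧-suc (a ∷ b ∷ c ∷ d ∷ []) j
  rewrite sym (nCk+nC[k+1]≡[n+1]C[k+1] j 1) | sym (nCk+nC[k+1]≡[n+1]C[k+1] j 2) | nC1≡n j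
  = expand a b c d j (j C 2) (j C 3)
  where
  expand : ∀ a b c d x y z →
    a + b * suc x + c * (x + y) + d * (y + z) ≡ a + b + (b + c) * x + (c + d) * y + d * z
  expand = solve-∀

shiftⁿ : ℕ → Poly → Poly
shiftⁿ zero p = p
shiftⁿ (suc k) p = shiftⁿ k (shift p)

⟦⟧-+ : ∀ k p j → ⟦ p ⟧ (k + j) ≡ ⟦ shiftⁿ k p ⟧ j
⟦⟧-+ zero p j = refl
⟦⟧-+ (suc k) p j = trans (⟦⟧-suc p (k + j)) (⟦⟧-+ k (shift p) j)

val : ℕ → Poly → ℕ
val j p = 2 ^ j * ⟦ p ⟧ j

val-𝟘 : ∀ j → val j 𝟘 ≡ 0
val-𝟘 j = *-zeroʳ (2 ^ j)

val-⨁ : ∀ j k (f : Fin k → Poly) → val j (⨁ k f) ≡ ∑ k (val j ∘ f)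
val-⨁ j zero f = val-𝟘 j
val-⨁ j (suc k) f = trans (cong (2 ^ j *_) (⟦⟧-⊕ (f fzero) (⨁ k (f ∘ fsuc)) j))
  (trans (*-distribˡ-+ (2 ^ j) (⟦ f fzero ⟧ j) _) (cong (val j (f fzero) +_) (val-⨁ j k (f ∘ fsuc))))

val-suc : ∀ j p → val (suc j) p ≡ val j (2 · shift p)
val-suc j p = begin
  2 * 2 ^ j * ⟦ p ⟧ (suc j)   ≡⟨ cong (2 * 2 ^ j *_) (⟦⟧-suc p j) ⟩
  2 * 2 ^ j * ⟦ shift p ⟧ j   ≡⟨ *-assoc 2 (2 ^ j) _ ⟩
  2 * (2 ^ j * ⟦ shift p ⟧ j) ≡⟨ *-exchange 2 (2 ^ j) _ ⟩
  2 ^ j * (2 * ⟦ shift p ⟧ j) ≡⟨ cong (2 ^ j *_) (⟦⟧-· 2 (shift p) j) ⟨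
  val j (2 · shift p) ∎
  where open ≡-Reasoning

branch-val : ∀ j (G : ℕ → ℕ → ℕ) (P : ℕ → ℕ → Poly) r m t → r ≤ 3 → m ≤ 3 → t ≤ 3 →
  (∀ r′ m′ → r′ ≤ 3 → m′ ≤ 3 → G r′ m′ ≡ val j (P r′ m′)) →
  branch 0 G r m t ≡ val j (branch 𝟘 P r m t)
branch-val j G P r m t r≤3 m≤3 t≤3 G≡P with t <ᵇ m | t ≡ᵇ 0 | choose2 t ≤ᵇ r
... | true | true | _ = G≡P r (m ∸ 1) r≤3 (≤-trans (m∸n≤m m 1) m≤3)
... | true | false | _ = sym (val-𝟘 j)
... | false | _ | true = G≡P (r ∸ choose2 t) t (≤-trans (m∸n≤m r (choose2 t)) r≤3) t≤3
... | false | _ | false = sym (val-𝟘 j)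

-- The coordinates of completions (9 + j) r m / 2 ^ j, for r, m ≤ 3.
table : ℕ → ℕ → Poly
table 0 0 = 256 ∷ 0 ∷ 0 ∷ 0 ∷ []
table 0 1 = 256 ∷ 0 ∷ 0 ∷ 0 ∷ []
table 0 2 = 128 ∷ 0 ∷ 0 ∷ 0 ∷ []
table 0 3 = 64 ∷ 0 ∷ 0 ∷ 0 ∷ []
table 1 0 = 448 ∷ 64 ∷ 0 ∷ 0 ∷ []
table 1 1 = 448 ∷ 64 ∷ 0 ∷ 0 ∷ []
table 1 2 = 256 ∷ 32 ∷ 0 ∷ 0 ∷ []
table 1 3 = 112 ∷ 16 ∷ 0 ∷ 0 ∷ []
table 2 0 = 432 ∷ 128 ∷ 16 ∷ 0 ∷ []
table 2 1 = 432 ∷ 128 ∷ 16 ∷ 0 ∷ []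
table 2 2 = 272 ∷ 72 ∷ 8 ∷ 0 ∷ []
table 2 3 = 104 ∷ 32 ∷ 4 ∷ 0 ∷ []
table 3 0 = 472 ∷ 168 ∷ 36 ∷ 4 ∷ []
table 3 1 = 472 ∷ 168 ∷ 36 ∷ 4 ∷ []
table 3 2 = 304 ∷ 100 ∷ 20 ∷ 2 ∷ []
table 3 3 = 143 ∷ 41 ∷ 9 ∷ 1 ∷ []
table _ _ = 𝟘

∀≤3 : {P : ℕ → ℕ → Set} → (∀ (r m : Fin 4) → P (toℕ r) (toℕ m)) →
  ∀ r m → r ≤ 3 → m ≤ 3 → P r m
∀≤3 {P} h r m r≤3 m≤3 =
  subst₂ P (toℕ-fromℕ< (s≤s r≤3)) (toℕ-fromℕ< (s≤s m≤3)) (h (fromℕ< (s≤s r≤3)) (fromℕ< (s≤s m≤3)))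

table-base : ∀ r m → r ≤ 3 → m ≤ 3 → completions 9 r m ≡ val 0 (table r m)
table-base = ∀≤3 (from-yes (all? λ (r : Fin 4) → all? λ (m : Fin 4) →
  completions 9 (toℕ r) (toℕ m) ≟ val 0 (table (toℕ r) (toℕ m))))

table-step : ∀ r m → r ≤ 3 → m ≤ 3 → ⨁ 4 (λ t → branch 𝟘 table r m (toℕ t)) ≡ 2 · shift (table r m)
table-step = ∀≤3 (from-yes (all? λ (r : Fin 4) → all? λ (m : Fin 4) →
  ≡-dec _≟_ (⨁ 4 (λ t → branch 𝟘 table (toℕ r) (toℕ m) (toℕ t))) (2 · shift (table (toℕ r) (toℕ m)))))

completions-closed-form : ∀ j r m → r ≤ 3 → m ≤ 3 → completions (9 + j) r m ≡ val j (table r m)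
completions-closed-form zero = table-base
completions-closed-form (suc j) r m r≤3 m≤3 = begin
  completions (10 + j) r m
    ≡⟨ completions-truncate (6 + j) r m r≤3 m≤3 ⟩
  ∑ 4 (λ t → branch 0 (completions (9 + j)) r m (toℕ t))
    ≡⟨ ∑-cong 4 (λ t → branch-val j (completions (9 + j)) table r m (toℕ t) r≤3 m≤3 (toℕ≤pred[n] t)
                          (completions-closed-form j)) ⟩
  ∑ 4 (λ t → val j (branch 𝟘 table r m (toℕ t)))
    ≡⟨ val-⨁ j 4 (λ t → branch 𝟘 table r m (toℕ t)) ⟨
  val j (⨁ 4 (λ t → branch 𝟘 table r m (toℕ t)))
    ≡⟨ cong (val j) (table-step r m r≤3 m≤3) ⟩
  val j (2 · shift (table r m))
    ≡⟨ val-suc j (table r m) ⟨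
  val (suc j) (table r m) ∎
  where open ≡-Reasoning

C2-shift : ∀ k j → (k + j) C 2 ≡ ⟦ shiftⁿ k (0 ∷ 0 ∷ 1 ∷ 0 ∷ []) ⟧ j
C2-shift k j = trans (sym (trans (+-identityʳ _) (+-identityʳ _))) (⟦⟧-+ k (0 ∷ 0 ∷ 1 ∷ 0 ∷ []) j)

C3-shift : ∀ k j → (k + j) C 3 ≡ ⟦ shiftⁿ k (0 ∷ 0 ∷ 0 ∷ 1 ∷ []) ⟧ j
C3-shift k j = trans (sym (+-identityʳ _)) (⟦⟧-+ k (0 ∷ 0 ∷ 0 ∷ 1 ∷ []) j)

formula-from-table : ∀ j →
  val j (table 3 0) ≡ ((6 + j) C 1) * 2 ^ (5 + j) + ((6 + j) C 2) * 2 ^ (4 + j) + ((5 + j) C 3) * 2 ^ (2 + j)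
formula-from-table j = begin
  val j (table 3 0)
    ≡⟨ expand (2 ^ j) j (j C 2) (j C 3) ⟩
  (6 + j) * 2 ^ (5 + j) + ⟦ shiftⁿ 6 (0 ∷ 0 ∷ 1 ∷ 0 ∷ []) ⟧ j * 2 ^ (4 + j)
    + ⟦ shiftⁿ 5 (0 ∷ 0 ∷ 0 ∷ 1 ∷ []) ⟧ j * 2 ^ (2 + j)
    ≡⟨ cong₂ _+_ (cong₂ _+_ (cong (_* 2 ^ (5 + j)) (nC1≡n (6 + j))) (cong (_* 2 ^ (4 + j)) (C2-shift 6 j)))
                 (cong (_* 2 ^ (2 + j)) (C3-shift 5 j)) ⟨
  ((6 + j) C 1) * 2 ^ (5 + j) + ((6 + j) C 2) * 2 ^ (4 + j) + ((5 + j) C 3) * 2 ^ (2 + j) ∎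
  where
  open ≡-Reasoning
  expand : ∀ X x y z → X * (472 + 168 * x + 36 * y + 4 * z)
    ≡ (6 + x) * (2 * (2 * (2 * (2 * (2 * X))))) + (15 + 6 * x + 1 * y + 0 * z) * (2 * (2 * (2 * (2 * X))))
      + (10 + 10 * x + 5 * y + 1 * z) * (2 * (2 * X))
  expand = solve-∀

completions-formula : ∀ n → 4 ≤ n →
  completions n 3 0
    ≡ ((n ∸ 3) C 1) * 2 ^ (n ∸ 4) + ((n ∸ 3) C 2) * 2 ^ (n ∸ 5) + ((n ∸ 4) C 3) * 2 ^ (n ∸ 7)
completions-formula 1 (s≤s ())
completions-formula 2 (s≤s (s≤s ()))
completions-formula 3 (s≤s (s≤s (s≤s ())))
completions-formula 4 _ = refl
completions-formula 5 _ = refl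
completions-formula 6 _ = refl
completions-formula 7 _ = refl
completions-formula 8 _ = refl
completions-formula (suc (suc (suc (suc (suc (suc (suc (suc (suc j))))))))) _ =
  trans (completions-closed-form j 3 0 ≤-refl z≤n) (formula-from-table j)

mainTheorem4 : (n : ℕ) → 4 ≤ n →
    countTarget n
      ≡ ((n ∸ 3) C 1) * 2 ^ (n ∸ 4) + ((n ∸ 3) C 2) * 2 ^ (n ∸ 5) + ((n ∸ 4) C 3) * 2 ^ (n ∸ 7)
mainTheorem4 n 4≤n = trans (countTarget≡completions n) (completions-formula n 4≤n)
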